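{- Let $k,l,n$ be positive integers with $l<n$, and let $\Delta:[1,n]\to\{0,1\}$ be a $2$-coloring of $[1,n]$. Suppose that the equation $kx+ly=z$ has no monochromatic solution with $x,y,z\in[1,n]$ (i.e. there are no $x,y,z\in[1,n]$ with $kx+ly=z$ and $\Delta(x)=\Delta(y)=\Delta(z)$). Assume also that $u\in[1,n-l]$ and $\delta\in\{0,1\}$ satisfy $\Delta(u)=\delta$ and $\Delta(u+l)=1-\delta$. (i) If $w$ is a positive integer with $w\leq (n-ku)/l$ and $\Delta(w)=\delta$, then $\Delta(w-hk)=\delta$ for every nonnegative integer $h$ with $w-hk>0$. (ii) If $w\in[1,n]$ and $\Delta(w)=1-\delta$, then $\Delta(w+hk)=1-\delta$ for every nonnegative integer $h$ with $w+hk\leq (n-ku)/l$.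
   Context: For integers $s\le t$, $[s,t]=\{x\in\mathbb{Z}: s\leq x\leq t\}$. A $2$-coloring of $[1,n]$ is a function $\Delta:[1,n]\to\{0,1\}$. The numbers $x,y,z$ in a solution need not be distinct. -}

module Defs where

open import Data.Nat using (ℕ; _+_; _*_; _≤_)
open import Data.Bool using (Bool)
open import Data.Product using (_×_)
open import Relation.Binary.PropositionalEquality using (_≡_)
open import Relation.Nullary using (¬_)

InRange : ℕ → ℕ → Set
InRange n x = 1 ≤ x × x ≤ n

-- A 2-coloring of [1,n] is represented as Δ : ℕ → Bool (colors 0,1 = false,true);
-- only its values on [1,n] are ever consulted.
-- No monochromatic solution of k x + l y = z with x,y,z ∈ [1,n].
NoMonoSol : ℕ → ℕ → ℕ → (ℕ → Bool) → Set
NoMonoSol k l n Δ =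
  ∀ x y z → InRange n x → InRange n y → InRange n z →
  k * x + l * y ≡ z → ¬ (Δ x ≡ Δ y × Δ y ≡ Δ z)

-- Write z = l (k + m) + k u.  It solves k x + l y = z both as (x, y) = (u, k + m) and as
-- (x, y) = (u + l, m).  Since Δ u = δ and Δ (u + l) = not δ, whatever colour z takes, one of
-- the two solutions forbids Δ (k + m) = δ together with Δ m = not δ.  Hence colour δ
-- propagates downwards and colour not δ upwards in steps of k, as long as z ≤ n.
{-# OPTIONS --safe #-}
module Submission where

open import Defs
open import Data.Nat using (ℕ; zero; suc; _+_; _*_; _∸_; _≤_; _<_; >-nonZero)
open import Data.Nat.Properties
open import Data.Nat.Tactic.RingSolver using (solve-∀)
open import Data.Bool using (Bool; not)
open import Data.Bool.Properties using (not-¬; ¬-not; not-involutive)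
open import Data.Product using (_×_; _,_)
open import Relation.Binary.PropositionalEquality

k[u+l]+lm≡l[k+m]+ku : ∀ k l u m → k * (u + l) + l * m ≡ l * (k + m) + k * u
k[u+l]+lm≡l[k+m]+ku = solve-∀

module _ (k l : ℕ) {n : ℕ} {Δ : ℕ → Bool} (noMono : NoMonoSol k l n Δ) where

  noMonoSol⇒Δy≡not-c : ∀ {x y z c} → InRange n x → InRange n y → InRange n z →
    k * x + l * y ≡ z → Δ x ≡ c → Δ z ≡ c → Δ y ≡ not c
  noMonoSol⇒Δy≡not-c x∈ y∈ z∈ sol Δx≡c Δz≡c =
    ¬-not λ Δy≡c → noMono _ _ _ x∈ y∈ z∈ sol (trans Δx≡c (sym Δy≡c) , trans Δy≡c (sym Δz≡c))

module Switch (k l n : ℕ) (1≤l : 1 ≤ l) (Δ : ℕ → Bool) (noMono : NoMonoSol k l n Δ)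
  (u : ℕ) (1≤u : 1 ≤ u) (u+l≤n : u + l ≤ n) (δ : Bool)
  (Δu≡δ : Δ u ≡ δ) (Δu+l≡notδ : Δ (u + l) ≡ not δ) where

  -- the paper's condition w ≤ (n − k u)/l, stated without division
  Bounded : ℕ → Set
  Bounded w = l * w + k * u ≤ n

  Bounded-antimono : ∀ {v w} → v ≤ w → Bounded w → Bounded v
  Bounded-antimono v≤w = ≤-trans (+-monoˡ-≤ (k * u) (*-monoʳ-≤ l v≤w))

  w≤lw+ku : ∀ w → w ≤ l * w + k * u
  w≤lw+ku w = ≤-trans (m≤n*m w l {{>-nonZero 1≤l}}) (m≤m+n (l * w) (k * u))

  Bounded⇒InRange : ∀ {w} → 1 ≤ w → Bounded w → InRange n w
  Bounded⇒InRange {w} 1≤w bound = 1≤w , ≤-trans (w≤lw+ku w) bound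

  Bounded⇒InRange-lw+ku : ∀ {w} → 1 ≤ w → Bounded w → InRange n (l * w + k * u)
  Bounded⇒InRange-lw+ku {w} 1≤w bound = ≤-trans 1≤w (w≤lw+ku w) , bound

  u∈ : InRange n u
  u∈ = 1≤u , ≤-trans (m≤m+n u l) u+l≤n

  u+l∈ : InRange n (u + l)
  u+l∈ = ≤-trans 1≤u (m≤m+n u l) , u+l≤n

  δ≢notδ : δ ≢ not δ
  δ≢notδ = not-¬ refl

  step-down : ∀ {m} → 1 ≤ m → Bounded (k + m) → Δ (k + m) ≡ δ → Δ m ≡ δ
  step-down {m} 1≤m bound Δk+m≡δ = begin
      Δ m         ≡⟨ noMonoSol⇒Δy≡not-c k l noMono u+l∈ m∈ z∈ sol₂ Δu+l≡notδ Δz≡notδ ⟩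
      not (not δ) ≡⟨ not-involutive δ ⟩
      δ           ∎
    where
    open ≡-Reasoning
    z : ℕ
    z = l * (k + m) + k * u
    1≤k+m : 1 ≤ k + m
    1≤k+m = ≤-trans 1≤m (m≤n+m m k)
    m∈ : InRange n m
    m∈ = Bounded⇒InRange 1≤m (Bounded-antimono (m≤n+m m k) bound)
    k+m∈ : InRange n (k + m)
    k+m∈ = Bounded⇒InRange 1≤k+m bound
    z∈ : InRange n z
    z∈ = Bounded⇒InRange-lw+ku 1≤k+m bound
    sol₁ : k * u + l * (k + m) ≡ z
    sol₁ = +-comm (k * u) (l * (k + m))
    sol₂ : k * (u + l) + l * m ≡ z
    sol₂ = k[u+l]+lm≡l[k+m]+ku k l u m
    Δz≡notδ : Δ z ≡ not δ
    Δz≡notδ = ¬-not λ Δz≡δ →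
      δ≢notδ (trans (sym Δk+m≡δ) (noMonoSol⇒Δy≡not-c k l noMono u∈ k+m∈ z∈ sol₁ Δu≡δ Δz≡δ))

  step-up : ∀ {m} → 1 ≤ m → Bounded (k + m) → Δ m ≡ not δ → Δ (k + m) ≡ not δ
  step-up 1≤m bound Δm≡notδ =
    ¬-not λ Δk+m≡δ → δ≢notδ (trans (sym (step-down 1≤m bound Δk+m≡δ)) Δm≡notδ)

  descend : ∀ h {m} → 1 ≤ m → Bounded (h * k + m) → Δ (h * k + m) ≡ δ → Δ m ≡ δ
  descend zero    1≤m bound Δ≡δ = Δ≡δ
  descend (suc h) {m} 1≤m bound Δ≡δ rewrite +-assoc k (h * k) m =
    descend h 1≤m (Bounded-antimono (m≤n+m (h * k + m) k) bound)
      (step-down (≤-trans 1≤m (m≤n+m m (h * k))) bound Δ≡δ)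

  ascend : ∀ h {m} → 1 ≤ m → Bounded (h * k + m) → Δ m ≡ not δ → Δ (h * k + m) ≡ not δ
  ascend zero    1≤m bound Δm≡notδ = Δm≡notδ
  ascend (suc h) {m} 1≤m bound Δm≡notδ rewrite +-assoc k (h * k) m =
    step-up (≤-trans 1≤m (m≤n+m m (h * k))) bound
      (ascend h 1≤m (Bounded-antimono (m≤n+m (h * k + m) k) bound) Δm≡notδ)

lemma2p1 : (k l n : ℕ) → 1 ≤ k → 1 ≤ l → l < n →
    (Δ : ℕ → Bool) → NoMonoSol k l n Δ →
    (u : ℕ) → InRange (n ∸ l) u → (δ : Bool) →
    Δ u ≡ δ → Δ (u + l) ≡ not δ →
    ((w : ℕ) → 1 ≤ w → l * w + k * u ≤ n → Δ w ≡ δ →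
       (h : ℕ) → h * k < w → Δ (w ∸ h * k) ≡ δ)
    ×
    ((w : ℕ) → InRange n w → Δ w ≡ not δ →
       (h : ℕ) → l * (w + h * k) + k * u ≤ n → Δ (w + h * k) ≡ not δ)
lemma2p1 k l n _ 1≤l l<n Δ noMono u (1≤u , u≤n∸l) δ Δu≡δ Δu+l≡notδ = part-i , part-ii
  where
  open Switch k l n 1≤l Δ noMono u 1≤u (m≤o∸n⇒m+n≤o u (<⇒≤ l<n) u≤n∸l) δ Δu≡δ Δu+l≡notδ

  part-i : (w : ℕ) → 1 ≤ w → Bounded w → Δ w ≡ δ → (h : ℕ) → h * k < w → Δ (w ∸ h * k) ≡ δ
  part-i w _ bound Δw≡δ h hk<w =
    descend h (m<n⇒0<n∸m hk<w) (subst Bounded (sym h*k+[w∸h*k]≡w) bound)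
      (subst (λ v → Δ v ≡ δ) (sym h*k+[w∸h*k]≡w) Δw≡δ)
    where
    h*k+[w∸h*k]≡w : h * k + (w ∸ h * k) ≡ w
    h*k+[w∸h*k]≡w = m+[n∸m]≡n (<⇒≤ hk<w)

  part-ii : (w : ℕ) → InRange n w → Δ w ≡ not δ →
            (h : ℕ) → Bounded (w + h * k) → Δ (w + h * k) ≡ not δ
  part-ii w (1≤w , _) Δw≡notδ h bound rewrite +-comm w (h * k) = ascend h 1≤w bound Δw≡notδ
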